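{- Let $n\ge1$ and let $I=\{i_1,i_2,\ldots,i_k\}\subseteq[n]$ with $1=i_1<i_2<\cdots<i_k\le n$ be such that there exists a Fubini ranking $\alpha$ with $n$ competitors and $\mathrm{Lucky}(\alpha)=I$. Set $i_{k+1}=n+1$. Then the number of Fubini rankings $\alpha$ with $n$ competitors satisfying $\mathrm{Lucky}(\alpha)=I$ is \[\prod_{\ell=1}^{k}\ell^{\,i_{\ell+1}-i_\ell}.\]
   Context: A Fubini ranking with $n$ competitors is a tuple $\alpha=(a_1,\ldots,a_n)\in[n]^n$ with $a_i=1+|\{j:a_j<a_i\}|$ for every $i$. Lucky cars: cars $1,\ldots,n$ enter in order a one-way street with spots $1,\ldots,n$; car $i$ parks at spot $a_i$ if free, else at the first free spot after $a_i$; car $i$ is lucky if it parks at spot $a_i$. $\mathrm{Lucky}(\alpha)$ denotes the set of lucky cars. -}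

module Defs where

open import Data.Nat using (ℕ; zero; suc; _+_; _*_; _∸_; _^_; _≤_; _<_; _≤?_; _<?_; _≟_)

open import Data.Fin using (Fin)
open import Data.Fin.Properties using (all?)
open import Data.Vec as V using (Vec; []; _∷_; lookup; toList)
open import Data.List as L using (List; []; _∷_; length; map; concatMap; upTo; filter)
open import Data.List.Properties using (≡-dec)
open import Data.List.Membership.DecPropositional _≟_ using (_∈?_)
open import Data.Product using (_×_)
open import Relation.Nullary using (Dec; yes; no)
open import Relation.Nullary.Decidable using (_×-dec_)
open import Relation.Binary.PropositionalEquality using (_≡_)

-- A tuple α = (a_1,…,a_n) is a Vec ℕ n; car/competitor i (1-based) is position i-1.

IsFubini : {n : ℕ} → Vec ℕ n → Set
IsFubini {n} α =
  (i : Fin n) → (1 ≤ lookup α i) × (lookup α i ≤ n)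
              × (lookup α i ≡ suc (V.count (_<? lookup α i) α))

isFubini? : {n : ℕ} → (α : Vec ℕ n) → Dec (IsFubini α)
isFubini? {n} α = all? λ i →
  (1 ≤? lookup α i) ×-dec ((lookup α i ≤? n)
    ×-dec (lookup α i ≟ suc (V.count (_<? lookup α i) α)))

-- Parking: first free spot at or after a (occupied spots in occ).
-- The fuel (length occ + 1) suffices since at most |occ| spots are occupied.
firstFree : ℕ → List ℕ → ℕ → ℕ
firstFree zero occ a = a
firstFree (suc f) occ a with a ∈? occ
... | yes _ = firstFree f occ (suc a)
... | no  _ = a

luckyAux : ℕ → List ℕ → List ℕ → List ℕ
luckyAux i occ [] = []
luckyAux i occ (a ∷ as) with a ∈? occ
... | yes _ = luckyAux (suc i) (firstFree (suc (length occ)) occ a ∷ occ) as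
... | no  _ = i ∷ luckyAux (suc i) (a ∷ occ) as

-- Lucky(α), as the increasing list of lucky cars (1-based).
Lucky : {n : ℕ} → Vec ℕ n → List ℕ
Lucky α = luckyAux 1 [] (toList α)

tuples : (m k : ℕ) → List (Vec ℕ k)
tuples m zero = [] ∷ []
tuples m (suc k) = concatMap (λ a → map (a ∷_) (tuples m k)) (map suc (upTo m))

numFubiniLucky : (n : ℕ) → List ℕ → ℕ
numFubiniLucky n I =
  length (filter (λ α → isFubini? α ×-dec ≡-dec _≟_ (Lucky α) I) (tuples n n))

-- prodFrom ℓ n (i_ℓ ∷ … ∷ i_k ∷ []) = ∏_{m=ℓ}^{k} m^(i_{m+1} - i_m), with i_{k+1} = n+1.
prodFrom : ℕ → ℕ → List ℕ → ℕ
prodFrom ℓ n [] = 1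
prodFrom ℓ n (i ∷ []) = ℓ ^ (suc n ∸ i)
prodFrom ℓ n (i ∷ j ∷ r) = ℓ ^ (j ∸ i) * prodFrom (suc ℓ) n (j ∷ r)

-- In a Fubini ranking the competitors tied at rank v park, in order, on the block of spots
-- v, v + 1, …, v + (multiplicity of v) - 1, and these blocks are disjoint.  So a car is lucky
-- exactly when its rank has not occurred before: Lucky α lists the first occurrences of ranks.
-- Removing the last competitor, and closing the gap in the ranks it may leave, maps the rankings
-- of n competitors with lucky set I onto those of n - 1 competitors with lucky set I ∖ {n}, and
-- every fibre has |I| elements: if n ∉ I the last competitor ties with one of the |I| ranks; if
-- n ∈ I it opens a new rank, just below one of the |I| - 1 existing ranks or on top of all.
-- The factor |I ∩ [n]| equals ℓ for i_ℓ ≤ n < i_{ℓ+1}, whence the product.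

module Submission where

open import Defs
open import Data.Nat using (ℕ; zero; suc; _+_; _*_; _∸_; _^_; _≤_; _<_; z≤n; s≤s; pred)
open import Data.Nat.Properties
open import Data.Empty using (⊥-elim)
open import Data.Product using (Σ; ∃; ∃₂; _×_; _,_; proj₁; proj₂)
open import Data.Sum using (_⊎_; inj₁; inj₂)
open import Data.Vec as Vec using (Vec; toList; fromList)
import Data.Vec.Properties as Vec
import Data.Vec.Relation.Unary.All.Properties as VecAll
open import Data.Vec.Relation.Binary.Equality.Cast using (cast-is-id)
open import Data.List as List using (List; []; _∷_; _++_; [_]; length; map; concatMap; filter; initLast; _∷ʳ′_)
import Data.List.Properties as List
open import Data.List.Relation.Unary.All as All using (All; []; _∷_)
open import Data.List.Relation.Unary.Any as Any using (Any; here; there)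
open import Data.List.Relation.Unary.Linked using (Linked; []; [-]; _∷_)
open import Data.List.Relation.Unary.AllPairs using ([]; _∷_)
open import Data.List.Relation.Unary.Unique.Propositional using (Unique)
import Data.List.Relation.Unary.Unique.Propositional.Properties as Unique
open import Data.List.Relation.Binary.Disjoint.Propositional using (Disjoint)
open import Data.List.Relation.Binary.Subset.Propositional using (_⊆_)
open import Data.List.Membership.Propositional using (_∈_; _∉_; find; lose)
open import Data.List.Membership.Propositional.Properties
open import Data.List.Membership.DecPropositional _≟_ using (_∈?_)
import Data.List.Relation.Unary.All.Properties as All
open import Function using (_∘_; id)
open import Function.Bundles using (_⇔_; mk⇔; Equivalence)
open import Level using (0ℓ)
open import Relation.Nullary using (Dec; yes; no; ¬_)
open import Relation.Nullary.Decidable using (_×-dec_)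
open import Relation.Unary using (Pred; Decidable; ∁)
open import Relation.Binary.PropositionalEquality hiding ([_])
open import Relation.Binary using (tri<; tri≈; tri>)

module _ {A : Set} where

  private
    ∈-++-∷⁻ : ∀ {x z : A} ys zs → z ∈ ys ++ x ∷ zs → z ≢ x → z ∈ ys ++ zs
    ∈-++-∷⁻ ys zs z∈ z≢x with ∈-++⁻ ys z∈
    ... | inj₁ z∈ys         = ∈-++⁺ˡ z∈ys
    ... | inj₂ (here z≡x)   = ⊥-elim (z≢x z≡x)
    ... | inj₂ (there z∈zs) = ∈-++⁺ʳ ys z∈zs

  length-∷ʳ : ∀ (xs : List A) {x} → length (xs ++ [ x ]) ≡ suc (length xs)
  length-∷ʳ xs = trans (List.length-++ xs) (+-comm (length xs) 1)

  length-∷ʳ-+ : ∀ (xs : List A) {x} n → length (xs ++ [ x ]) + n ≡ length xs + suc n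
  length-∷ʳ-+ xs n = trans (cong (_+ n) (length-∷ʳ xs)) (sym (+-suc (length xs) n))

  ∈-∷ʳ⁻ : ∀ {z a : A} xs → z ∈ xs ++ [ a ] → z ∈ xs ⊎ z ≡ a
  ∈-∷ʳ⁻ xs z∈ with ∈-++⁻ xs z∈
  ... | inj₁ z∈xs      = inj₁ z∈xs
  ... | inj₂ (here z≡a) = inj₂ z≡a

  ∷ʳ-view : ∀ {n} (z : List A) → length z ≡ suc n → ∃₂ λ β w → z ≡ β ++ [ w ] × length β ≡ n
  ∷ʳ-view z length≡ with initLast z
  ... | []      = ⊥-elim (0≢1+n length≡)
  ... | β ∷ʳ′ w = β , w , refl , suc-injective (trans (sym (length-∷ʳ β)) length≡)

  Linked-∷ʳ⁻ : ∀ {R : A → A → Set} ys {x} → Linked R (ys ++ [ x ]) → Linked R ys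
  Linked-∷ʳ⁻ []           _         = []
  Linked-∷ʳ⁻ (y ∷ [])     _         = [-]
  Linked-∷ʳ⁻ (y ∷ z ∷ ys) (r ∷ rs) = r ∷ Linked-∷ʳ⁻ (z ∷ ys) rs

  Unique⇒length≤ : {xs ys : List A} → Unique xs → xs ⊆ ys → length xs ≤ length ys
  Unique⇒length≤ {[]}     _            _     = z≤n
  Unique⇒length≤ {x ∷ xs} (x∉xs ∷ xs!) xs⊆ys with ∈-∃++ (xs⊆ys (here refl))
  ... | ys₁ , ys₂ , refl = begin
    suc (length xs)                ≤⟨ s≤s (Unique⇒length≤ xs! xs⊆ys₁ys₂) ⟩
    suc (length (ys₁ ++ ys₂))      ≡⟨ cong suc (List.length-++ ys₁) ⟩
    suc (length ys₁ + length ys₂)  ≡⟨ +-suc (length ys₁) (length ys₂) ⟨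
    length ys₁ + length (x ∷ ys₂)  ≡⟨ List.length-++ ys₁ ⟨
    length (ys₁ ++ x ∷ ys₂)        ∎
    where
    open ≤-Reasoning
    xs⊆ys₁ys₂ : xs ⊆ ys₁ ++ ys₂
    xs⊆ys₁ys₂ z∈xs = ∈-++-∷⁻ ys₁ ys₂ (xs⊆ys (there z∈xs)) λ where refl → All.lookup x∉xs z∈xs refl

  Unique⇒length≡ : {xs ys : List A} → Unique xs → Unique ys → xs ⊆ ys → ys ⊆ xs → length xs ≡ length ys
  Unique⇒length≡ xs! ys! xs⊆ys ys⊆xs = ≤-antisym (Unique⇒length≤ xs! xs⊆ys) (Unique⇒length≤ ys! ys⊆xs)

module _ {A B C : Set} (pair : A → B → C)
         (pair-injective : ∀ {a a′ b b′} → pair a b ≡ pair a′ b′ → a ≡ a′ × b ≡ b′)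
         (fibre : A → List B) where

  dependentPairs : List A → List C
  dependentPairs = concatMap (λ a → map (pair a) (fibre a))

  ∈-dependentPairs⁺ : ∀ {xs a b} → a ∈ xs → b ∈ fibre a → pair a b ∈ dependentPairs xs
  ∈-dependentPairs⁺ a∈xs b∈ = ∈-concatMap⁺ (λ a → map (pair a) (fibre a)) (lose a∈xs (∈-map⁺ (pair _) b∈))

  ∈-dependentPairs⁻ : ∀ xs {c} → c ∈ dependentPairs xs → ∃₂ λ a b → a ∈ xs × b ∈ fibre a × c ≡ pair a b
  ∈-dependentPairs⁻ xs c∈ with a , a∈xs , c∈′ ← find (∈-concatMap⁻ (λ a → map (pair a) (fibre a)) {xs = xs} c∈)
                          with b , b∈ , refl ← ∈-map⁻ (pair a) c∈′
    = a , b , a∈xs , b∈ , refl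

  dependentPairs-unique : ∀ {xs} → Unique xs → All (Unique ∘ fibre) xs → Unique (dependentPairs xs)
  dependentPairs-unique []               []                 = []
  dependentPairs-unique {a ∷ xs} (a∉xs ∷ xs!) (fibre! ∷ fibres!) =
    Unique.++⁺ (Unique.map⁺ (proj₂ ∘ pair-injective) fibre!) (dependentPairs-unique xs! fibres!) disjoint
    where
    disjoint : Disjoint (map (pair a) (fibre a)) (dependentPairs xs)
    disjoint (c∈ , c∈′) with _ , _ , refl ← ∈-map⁻ (pair a) c∈
                        with _ , _ , a′∈xs , _ , eq ← ∈-dependentPairs⁻ xs c∈′
      = All.lookup a∉xs a′∈xs (proj₁ (pair-injective eq))

  length-dependentPairs : ∀ {xs} c → All (λ a → length (fibre a) ≡ c) xs → length (dependentPairs xs) ≡ length xs * c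
  length-dependentPairs c [] = refl
  length-dependentPairs {a ∷ xs} c (length≡c ∷ lengths≡c) = begin
    length (map (pair a) (fibre a) ++ dependentPairs xs)       ≡⟨ List.length-++ (map (pair a) (fibre a)) ⟩
    length (map (pair a) (fibre a)) + length (dependentPairs xs) ≡⟨ cong₂ _+_ (trans (List.length-map (pair a) (fibre a)) length≡c)
                                                                              (length-dependentPairs c lengths≡c) ⟩
    c + length xs * c                                            ∎
    where open ≡-Reasoning

  length-uniformFibres : ∀ {xs ys} c → Unique xs → Unique ys
    → All (λ a → Unique (fibre a) × length (fibre a) ≡ c) xs
    → (∀ {z} → z ∈ ys → ∃₂ λ a b → a ∈ xs × b ∈ fibre a × z ≡ pair a b)
    → (∀ {a b} → a ∈ xs → b ∈ fibre a → pair a b ∈ ys)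
    → length ys ≡ length xs * c
  length-uniformFibres {xs} {ys} c xs! ys! fibres onto into = begin
    length ys                  ≡⟨ Unique⇒length≡ ys! (dependentPairs-unique xs! (All.map proj₁ fibres)) ys⊆ ⊆ys ⟩
    length (dependentPairs xs) ≡⟨ length-dependentPairs c (All.map proj₂ fibres) ⟩
    length xs * c              ∎
    where
    open ≡-Reasoning
    ys⊆ : ys ⊆ dependentPairs xs
    ys⊆ z∈ with _ , _ , a∈ , b∈ , refl ← onto z∈ = ∈-dependentPairs⁺ a∈ b∈
    ⊆ys : dependentPairs xs ⊆ ys
    ⊆ys c∈ with _ , _ , a∈ , b∈ , refl ← ∈-dependentPairs⁻ xs c∈ = into a∈ b∈

count : {A : Set} {P : Pred A 0ℓ} → Decidable P → List A → ℕ
count P? []       = 0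
count P? (x ∷ xs) with P? x
... | yes _ = suc (count P? xs)
... | no  _ = count P? xs

module _ {A : Set} {P : Pred A 0ℓ} (P? : Decidable P) where

  count-++ : ∀ xs ys → count P? (xs ++ ys) ≡ count P? xs + count P? ys
  count-++ []       ys = refl
  count-++ (x ∷ xs) ys with P? x
  ... | yes _ = cong suc (count-++ xs ys)
  ... | no  _ = count-++ xs ys

  count-∷ʳ-accept : ∀ xs {x} → P x → count P? (xs ++ [ x ]) ≡ suc (count P? xs)
  count-∷ʳ-accept []       {x} px with P? x
  ... | yes _  = refl
  ... | no ¬px = ⊥-elim (¬px px)
  count-∷ʳ-accept (y ∷ xs)     px with P? y
  ... | yes _ = cong suc (count-∷ʳ-accept xs px)
  ... | no  _ = count-∷ʳ-accept xs px

  count-∷ʳ-reject : ∀ xs {x} → ¬ P x → count P? (xs ++ [ x ]) ≡ count P? xs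
  count-∷ʳ-reject []       {x} ¬px with P? x
  ... | yes px = ⊥-elim (¬px px)
  ... | no  _  = refl
  count-∷ʳ-reject (y ∷ xs)     ¬px with P? y
  ... | yes _ = cong suc (count-∷ʳ-reject xs ¬px)
  ... | no  _ = count-∷ʳ-reject xs ¬px

  count≤length : ∀ xs → count P? xs ≤ length xs
  count≤length []       = z≤n
  count≤length (x ∷ xs) with P? x
  ... | yes _ = s≤s (count≤length xs)
  ... | no  _ = m≤n⇒m≤1+n (count≤length xs)

  count<length : ∀ {xs} → Any (∁ P) xs → count P? xs < length xs
  count<length {x ∷ xs} (here ¬px) with P? x
  ... | yes px = ⊥-elim (¬px px)
  ... | no  _  = s≤s (count≤length xs)
  count<length {x ∷ xs} (there any) with P? x
  ... | yes _ = s≤s (count<length any)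
  ... | no  _ = m<n⇒m<1+n (count<length any)

  count-all : ∀ {xs} → All P xs → count P? xs ≡ length xs
  count-all {[]}     []         = refl
  count-all {x ∷ xs} (px ∷ pxs) with P? x
  ... | yes _  = cong suc (count-all pxs)
  ... | no ¬px = ⊥-elim (¬px px)

  count-none : ∀ {xs} → All (∁ P) xs → count P? xs ≡ 0
  count-none {[]}     []           = refl
  count-none {x ∷ xs} (¬px ∷ ¬pxs) with P? x
  ... | yes px = ⊥-elim (¬px px)
  ... | no  _  = count-none ¬pxs

  count>0⇒Any : ∀ xs → 0 < count P? xs → Any P xs
  count>0⇒Any (x ∷ xs) count>0 with P? x
  ... | yes px = here px
  ... | no  _  = there (count>0⇒Any xs count>0)

  Any⇒count>0 : ∀ {xs} → Any P xs → 0 < count P? xs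
  Any⇒count>0 {x ∷ xs} any with P? x | any
  ... | yes _  | _          = s≤s z≤n
  ... | no ¬px | here px    = ⊥-elim (¬px px)
  ... | no _   | there any′ = Any⇒count>0 any′

module _ {A : Set} {P Q : Pred A 0ℓ} (P? : Decidable P) (Q? : Decidable Q) where

  count-mono : (∀ {x} → P x → Q x) → ∀ xs → count P? xs ≤ count Q? xs
  count-mono P⇒Q []       = z≤n
  count-mono P⇒Q (x ∷ xs) with P? x | Q? x
  ... | yes _  | yes _  = s≤s (count-mono P⇒Q xs)
  ... | yes px | no ¬qx = ⊥-elim (¬qx (P⇒Q px))
  ... | no _   | yes _  = m≤n⇒m≤1+n (count-mono P⇒Q xs)
  ... | no _   | no _   = count-mono P⇒Q xs

module _ {A B : Set} {P : Pred B 0ℓ} {Q : Pred A 0ℓ} (P? : Decidable P) (Q? : Decidable Q) where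

  count-map : (f : A → B) → (∀ {y} → P (f y) ⇔ Q y) → ∀ xs → count P? (map f xs) ≡ count Q? xs
  count-map f Pf⇔Q []       = refl
  count-map f Pf⇔Q (x ∷ xs) with P? (f x) | Q? x
  ... | yes _   | yes _  = cong suc (count-map f Pf⇔Q xs)
  ... | yes pfx | no ¬qx = ⊥-elim (¬qx (Equivalence.to Pf⇔Q pfx))
  ... | no ¬pfx | yes qx = ⊥-elim (¬pfx (Equivalence.from Pf⇔Q qx))
  ... | no _    | no _   = count-map f Pf⇔Q xs

count-toList : ∀ {A : Set} {P : Pred A 0ℓ} (P? : Decidable P) {n} (α : Vec A n) → Vec.count P? α ≡ count P? (toList α)
count-toList P? Vec.[]         = refl
count-toList P? (x Vec.∷ α) with P? x
... | yes _ = cong suc (count-toList P? α)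
... | no  _ = count-toList P? α

-- Fubini rankings as lists

countBelow : ℕ → List ℕ → ℕ
countBelow a = count (_<? a)

multiplicity : ℕ → List ℕ → ℕ
multiplicity a = count (a ≟_)

countBelow-suc : ∀ v xs → countBelow (suc v) xs ≡ countBelow v xs + multiplicity v xs
countBelow-suc v []       = refl
countBelow-suc v (x ∷ xs) with x <? suc v | x <? v | v ≟ x
... | yes _   | yes x<v | yes refl = ⊥-elim (<-irrefl refl x<v)
... | yes _   | yes _   | no _     = cong suc (countBelow-suc v xs)
... | yes _   | no _    | yes refl = trans (cong suc (countBelow-suc v xs)) (sym (+-suc _ _))
... | yes x<1+v | no x≮v | no v≢x  = ⊥-elim (v≢x (≤-antisym (≮⇒≥ x≮v) (≤-pred x<1+v)))
... | no x≮1+v | yes x<v | _       = ⊥-elim (x≮1+v (m<n⇒m<1+n x<v))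
... | no x≮1+v | no _   | yes refl = ⊥-elim (x≮1+v ≤-refl)
... | no _    | no _    | no _     = countBelow-suc v xs

IsFubiniList : List ℕ → Set
IsFubiniList xs = All (λ a → a ≡ suc (countBelow a xs)) xs

-- The competitors tied at rank v park on the spots v, v+1, …, v + multiplicity v xs - 1.
InBlock : List ℕ → ℕ → ℕ → Set
InBlock xs v t = v ≤ t × t < v + multiplicity v xs

inBlock⇒∈ : ∀ {xs v t} → InBlock xs v t → v ∈ xs
inBlock⇒∈ {xs} {v} (v≤t , t<v+m) =
  count>0⇒Any (v ≟_) xs (+-cancelˡ-< v 0 _ (subst (_< v + multiplicity v xs) (sym (+-identityʳ v)) (≤-<-trans v≤t t<v+m)))

inBlock-++ : ∀ p q {v t} → InBlock p v t → InBlock (p ++ q) v t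
inBlock-++ p q {v} (v≤t , t<v+m) = v≤t , <-≤-trans t<v+m (+-monoʳ-≤ v multiplicity≤)
  where
  multiplicity≤ : multiplicity v p ≤ multiplicity v (p ++ q)
  multiplicity≤ = subst (multiplicity v p ≤_) (sym (count-++ (v ≟_) p q)) (m≤m+n _ _)

module _ {xs : List ℕ} (fubini : IsFubiniList xs) where

  fubini-≤-length : ∀ {a} → a ∈ xs → a ≤ length xs
  fubini-≤-length {a} a∈xs = begin
    a                      ≡⟨ All.lookup fubini a∈xs ⟩
    suc (countBelow a xs)  ≤⟨ count<length (_<? a) (Any.map (λ where refl → <-irrefl refl) a∈xs) ⟩
    length xs              ∎
    where open ≤-Reasoning

  fubini-separated : ∀ {v u} → v ∈ xs → u ∈ xs → v < u → v + multiplicity v xs ≤ u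
  fubini-separated {v} {u} v∈xs u∈xs v<u = begin
    v + multiplicity v xs                         ≡⟨ cong (_+ multiplicity v xs) (All.lookup fubini v∈xs) ⟩
    suc (countBelow v xs + multiplicity v xs)     ≡⟨ cong suc (countBelow-suc v xs) ⟨
    suc (countBelow (suc v) xs)                   ≤⟨ s≤s (count-mono (_<? suc v) (_<? u) (λ x<1+v → <-≤-trans x<1+v v<u) xs) ⟩
    suc (countBelow u xs)                         ≡⟨ All.lookup fubini u∈xs ⟨
    u                                             ∎
    where open ≤-Reasoning

  fubini-inBlock-≮ : ∀ {v u t} → InBlock xs v t → InBlock xs u t → ¬ v < u
  fubini-inBlock-≮ v-block@(_ , t<v+m) u-block@(u≤t , _) v<u =
    <⇒≱ t<v+m (≤-trans (fubini-separated (inBlock⇒∈ v-block) (inBlock⇒∈ u-block) v<u) u≤t)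

  fubini-inBlock-unique : ∀ {v u t} → InBlock xs v t → InBlock xs u t → v ≡ u
  fubini-inBlock-unique {v} {u} v-block u-block with <-cmp v u
  ... | tri< v<u _ _ = ⊥-elim (fubini-inBlock-≮ v-block u-block v<u)
  ... | tri≈ _ v≡u _ = v≡u
  ... | tri> _ _ u<v = ⊥-elim (fubini-inBlock-≮ u-block v-block u<v)

  fubini-countBelow-top : countBelow (suc (length xs)) xs ≡ length xs
  fubini-countBelow-top = count-all (_<? suc (length xs)) (All.tabulate (s≤s ∘ fubini-≤-length))

  fubini-∈ : ∀ {r} → r ≡ suc (countBelow r xs) → r ≤ length xs → r ∈ xs
  fubini-∈ {r} r≡ r≤length = search (suc (length xs) ∸ r) r (m∸n+n≡m (m≤n⇒m≤1+n r≤length)) refl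
    where
    -- Scanning upwards from r, the first rank met is r itself: no rank lies in [r, k).
    search : ∀ d k → d + k ≡ suc (length xs) → countBelow k xs ≡ countBelow r xs → r ∈ xs
    search zero k refl below≡ = ⊥-elim (<⇒≱ (s≤s r≤length) (≤-reflexive (begin
      suc (length xs)                        ≡⟨ cong suc fubini-countBelow-top ⟨
      suc (countBelow (suc (length xs)) xs)  ≡⟨ cong suc below≡ ⟩
      suc (countBelow r xs)                  ≡⟨ r≡ ⟨
      r                                      ∎)))
      where open ≡-Reasoning
    search (suc d) k d+k≡ below≡ with k ∈? xs
    ... | yes k∈xs = subst (_∈ xs) (trans (All.lookup fubini k∈xs) (trans (cong suc below≡) (sym r≡))) k∈xs
    ... | no  k∉xs = search d (suc k) (trans (+-suc d k) d+k≡) (begin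
      countBelow (suc k) xs                    ≡⟨ countBelow-suc k xs ⟩
      countBelow k xs + multiplicity k xs      ≡⟨ cong (countBelow k xs +_) (count-none (k ≟_) (All.¬Any⇒All¬ xs k∉xs)) ⟩
      countBelow k xs + 0                      ≡⟨ +-identityʳ _ ⟩
      countBelow k xs                          ≡⟨ below≡ ⟩
      countBelow r xs                          ∎)
      where open ≡-Reasoning

-- First occurrences

-- Positions are numbered after those of seen.
firstOccurrences : List ℕ → List ℕ → List ℕ
firstOccurrences seen []      = []
firstOccurrences seen (a ∷ l) with a ∈? seen
... | yes _ = firstOccurrences (seen ++ [ a ]) l
... | no  _ = suc (length seen) ∷ firstOccurrences (seen ++ [ a ]) l

distinctValues : List ℕ → List ℕ → List ℕ
distinctValues seen []      = []
distinctValues seen (a ∷ l) with a ∈? seen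
... | yes _ = distinctValues (seen ++ [ a ]) l
... | no  _ = a ∷ distinctValues (seen ++ [ a ]) l

length-distinctValues : ∀ seen l → length (distinctValues seen l) ≡ length (firstOccurrences seen l)
length-distinctValues seen []      = refl
length-distinctValues seen (a ∷ l) with a ∈? seen
... | yes _ = length-distinctValues (seen ++ [ a ]) l
... | no  _ = cong suc (length-distinctValues (seen ++ [ a ]) l)

firstOccurrences-++ : ∀ seen l m →
  firstOccurrences seen (l ++ m) ≡ firstOccurrences seen l ++ firstOccurrences (seen ++ l) m
firstOccurrences-++ seen []      m = cong (λ s → firstOccurrences s m) (sym (List.++-identityʳ seen))
firstOccurrences-++ seen (a ∷ l) m
  with a ∈? seen
     | trans (firstOccurrences-++ (seen ++ [ a ]) l m)
             (cong (λ s → firstOccurrences (seen ++ [ a ]) l ++ firstOccurrences s m) (List.++-assoc seen [ a ] l))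
... | yes _ | ih = ih
... | no  _ | ih = cong (suc (length seen) ∷_) ih

firstOccurrences-[∈] : ∀ {w seen} → w ∈ seen → firstOccurrences seen [ w ] ≡ []
firstOccurrences-[∈] {w} {seen} w∈ with w ∈? seen
... | yes _ = refl
... | no w∉ = ⊥-elim (w∉ w∈)

firstOccurrences-[∉] : ∀ {w seen} → w ∉ seen → firstOccurrences seen [ w ] ≡ [ suc (length seen) ]
firstOccurrences-[∉] {w} {seen} w∉ with w ∈? seen
... | yes w∈ = ⊥-elim (w∉ w∈)
... | no _   = refl

firstOccurrences-∷ʳ-∈ : ∀ {w} β → w ∈ β → firstOccurrences [] (β ++ [ w ]) ≡ firstOccurrences [] β
firstOccurrences-∷ʳ-∈ β w∈β = begin
  firstOccurrences [] (β ++ [ _ ])                  ≡⟨ firstOccurrences-++ [] β [ _ ] ⟩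
  firstOccurrences [] β ++ firstOccurrences β [ _ ] ≡⟨ cong (firstOccurrences [] β ++_) (firstOccurrences-[∈] w∈β) ⟩
  firstOccurrences [] β ++ []                       ≡⟨ List.++-identityʳ _ ⟩
  firstOccurrences [] β                             ∎
  where open ≡-Reasoning

firstOccurrences-∷ʳ-∉ : ∀ {w} β → w ∉ β → firstOccurrences [] (β ++ [ w ]) ≡ firstOccurrences [] β ++ [ suc (length β) ]
firstOccurrences-∷ʳ-∉ β w∉β = trans (firstOccurrences-++ [] β [ _ ]) (cong (firstOccurrences [] β ++_) (firstOccurrences-[∉] w∉β))

firstOccurrences-map : ∀ {f : ℕ → ℕ} → (∀ {x y} → f x ≡ f y → x ≡ y) →
  ∀ seen l → firstOccurrences (map f seen) (map f l) ≡ firstOccurrences seen l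
firstOccurrences-map         f-inj seen []      = refl
firstOccurrences-map {f = f} f-inj seen (a ∷ l) with f a ∈? map f seen | a ∈? seen
... | yes _   | yes _ = trans (cong (λ s → firstOccurrences s (map f l)) (sym (List.map-++ f seen [ a ])))
                              (firstOccurrences-map f-inj (seen ++ [ a ]) l)
... | yes fa∈ | no a∉ = ⊥-elim (a∉ (reflect fa∈))
  where
  reflect : f a ∈ map f seen → a ∈ seen
  reflect fa∈ with x , x∈ , fa≡fx ← ∈-map⁻ f fa∈ = subst (_∈ seen) (sym (f-inj fa≡fx)) x∈
... | no fa∉  | yes a∈ = ⊥-elim (fa∉ (∈-map⁺ f a∈))
... | no _    | no _  = cong₂ _∷_ (cong suc (List.length-map f seen))
                              (trans (cong (λ s → firstOccurrences s (map f l)) (sym (List.map-++ f seen [ a ])))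
                                     (firstOccurrences-map f-inj (seen ++ [ a ]) l))

firstOccurrences-≤ : ∀ seen l {z} → z ∈ firstOccurrences seen l → z ≤ length seen + length l
firstOccurrences-≤ seen (a ∷ l) z∈ with a ∈? seen | z∈
... | yes _ | z∈′       = ≤-trans (firstOccurrences-≤ (seen ++ [ a ]) l z∈′) (≤-reflexive (length-∷ʳ-+ seen (length l)))
... | no _  | here refl = ≤-trans (s≤s (m≤m+n _ _)) (≤-reflexive (sym (+-suc (length seen) (length l))))
... | no _  | there z∈′ = ≤-trans (firstOccurrences-≤ (seen ++ [ a ]) l z∈′) (≤-reflexive (length-∷ʳ-+ seen (length l)))

∈-distinctValues⁻ : ∀ seen l {z} → z ∈ distinctValues seen l → z ∈ l
∈-distinctValues⁻ seen (a ∷ l) z∈ with a ∈? seen | z∈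
... | yes _ | z∈′        = there (∈-distinctValues⁻ (seen ++ [ a ]) l z∈′)
... | no _  | here z≡a   = here z≡a
... | no _  | there z∈′ = there (∈-distinctValues⁻ (seen ++ [ a ]) l z∈′)

distinctValues-fresh : ∀ seen l {z} → z ∈ distinctValues seen l → z ∉ seen
distinctValues-fresh seen (a ∷ l) z∈ z∈seen with a ∈? seen | z∈
... | yes _  | z∈′       = distinctValues-fresh (seen ++ [ a ]) l z∈′ (∈-++⁺ˡ z∈seen)
... | no a∉  | here refl = a∉ z∈seen
... | no _   | there z∈′ = distinctValues-fresh (seen ++ [ a ]) l z∈′ (∈-++⁺ˡ z∈seen)

∈-distinctValues⁺ : ∀ seen l {z} → z ∈ l → z ∈ seen ⊎ z ∈ distinctValues seen l
∈-distinctValues⁺ seen (a ∷ l) {z} z∈ with a ∈? seen | z∈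
... | yes a∈ | here refl = inj₁ a∈
... | no _   | here refl = inj₂ (here refl)
... | yes a∈ | there z∈l with ∈-distinctValues⁺ (seen ++ [ a ]) l z∈l
...   | inj₂ z∈dv = inj₂ z∈dv
...   | inj₁ z∈seen′ with ∈-∷ʳ⁻ seen z∈seen′
...     | inj₁ z∈seen = inj₁ z∈seen
...     | inj₂ refl   = inj₁ a∈
∈-distinctValues⁺ seen (a ∷ l) {z} z∈ | no _ | there z∈l with ∈-distinctValues⁺ (seen ++ [ a ]) l z∈l
...   | inj₂ z∈dv = inj₂ (there z∈dv)
...   | inj₁ z∈seen′ with ∈-∷ʳ⁻ seen z∈seen′
...     | inj₁ z∈seen = inj₁ z∈seen
...     | inj₂ refl   = inj₂ (here refl)

∈-distinctValues[]⁺ : ∀ {l z} → z ∈ l → z ∈ distinctValues [] l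
∈-distinctValues[]⁺ {l} z∈l with ∈-distinctValues⁺ [] l z∈l
... | inj₂ z∈dv = z∈dv

distinctValues-unique : ∀ seen l → Unique (distinctValues seen l)
distinctValues-unique seen []      = []
distinctValues-unique seen (a ∷ l) with a ∈? seen
... | yes _ = distinctValues-unique (seen ++ [ a ]) l
... | no  _ = All.tabulate (λ z∈ a≡z → distinctValues-fresh (seen ++ [ a ]) l z∈ (∈-++⁺ʳ seen (here (sym a≡z))))
            ∷ distinctValues-unique (seen ++ [ a ]) l

-- Parking

firstFree-skip : ∀ c f a occ → c ≤ f → (∀ {j} → j < c → a + j ∈ occ) → a + c ∉ occ → firstFree f occ a ≡ a + c
firstFree-skip zero    zero    a occ _         _        _    = sym (+-identityʳ a)
firstFree-skip zero    (suc f) a occ _         _        free with a ∈? occ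
... | yes a∈ = ⊥-elim (free (subst (_∈ occ) (sym (+-identityʳ a)) a∈))
... | no  _  = sym (+-identityʳ a)
firstFree-skip (suc c) (suc f) a occ (s≤s c≤f) occupied free with a ∈? occ
... | yes _  = trans (firstFree-skip c f (suc a) occ c≤f occupied′ free′) (sym (+-suc a c))
  where
  occupied′ : ∀ {j} → j < c → suc a + j ∈ occ
  occupied′ {j} j<c = subst (_∈ occ) (+-suc a j) (occupied (s≤s j<c))
  free′ : suc a + c ∉ occ
  free′ = free ∘ subst (_∈ occ) (sym (+-suc a c))
... | no a∉ = ⊥-elim (a∉ (subst (_∈ occ) (+-identityʳ a) (occupied (s≤s z≤n))))

record ParkedInBlocks (p occ : List ℕ) : Set where
  field
    occupied⇒inBlock : ∀ {t} → t ∈ occ → ∃ λ v → InBlock p v t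
    inBlock⇒occupied : ∀ {v t} → InBlock p v t → t ∈ occ
    length-occupied  : length occ ≡ length p

parkedInBlocks-[] : ParkedInBlocks [] []
parkedInBlocks-[] = record
  { occupied⇒inBlock = λ ()
  ; inBlock⇒occupied = λ (v≤t , t<v+0) → ⊥-elim (<⇒≱ t<v+0 (subst (_≤ _) (sym (+-identityʳ _)) v≤t))
  ; length-occupied  = refl
  }

-- The car with preference a, arriving after the cars with preferences p, parks on a + multiplicity a p.
module ParkingStep {p l occ : List ℕ} {a : ℕ}
                   (fubini : IsFubiniList (p ++ a ∷ l)) (parked : ParkedInBlocks p occ) where

  open ParkedInBlocks parked

  private
    c : ℕ
    c = multiplicity a p

    inBlock-++ᴬ : ∀ {v t} → InBlock p v t → InBlock (p ++ a ∷ l) v t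
    inBlock-++ᴬ = inBlock-++ p (a ∷ l)

    inBlock-a : ∀ {j} → j ≤ c → InBlock (p ++ a ∷ l) a (a + j)
    inBlock-a {j} j≤c = m≤m+n a j , +-monoʳ-< a (≤-<-trans j≤c c<multiplicity)
      where
      c<multiplicity : c < multiplicity a (p ++ a ∷ l)
      c<multiplicity = subst (c <_) (sym (count-++ (a ≟_) p (a ∷ l))) (m<m+n c (Any⇒count>0 (a ≟_) (here refl)))

    a-block : InBlock (p ++ a ∷ l) a a
    a-block = subst (InBlock (p ++ a ∷ l) a) (+-identityʳ a) (inBlock-a z≤n)

  spot-free : a + c ∉ occ
  spot-free s∈ with v , v-block ← occupied⇒inBlock s∈
               with refl ← fubini-inBlock-unique fubini (inBlock-++ᴬ v-block) (inBlock-a ≤-refl)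
    = <-irrefl refl (proj₂ v-block)

  occupied-below-spot : ∀ {j} → j < c → a + j ∈ occ
  occupied-below-spot {j} j<c = inBlock⇒occupied (m≤m+n a j , +-monoʳ-< a j<c)

  occupied⇒seen : a ∈ occ → a ∈ p
  occupied⇒seen a∈ with v , v-block ← occupied⇒inBlock a∈
                   with refl ← fubini-inBlock-unique fubini (inBlock-++ᴬ v-block) a-block
    = inBlock⇒∈ v-block

  seen⇒occupied : a ∈ p → a ∈ occ
  seen⇒occupied a∈p = inBlock⇒occupied (≤-refl , m<m+n a (Any⇒count>0 (a ≟_) a∈p))

  firstFree≡spot : firstFree (suc (length occ)) occ a ≡ a + c
  firstFree≡spot = firstFree-skip c _ a occ c≤fuel occupied-below-spot spot-free
    where
    c≤fuel : c ≤ suc (length occ)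
    c≤fuel = m≤n⇒m≤1+n (subst (c ≤_) (sym length-occupied) (count≤length (a ≟_) p))

  parked-step : ParkedInBlocks (p ++ [ a ]) (a + c ∷ occ)
  parked-step = record
    { occupied⇒inBlock = λ where
        (here refl)  → a , m≤m+n a c , subst (λ m → a + c < a + m) (sym multiplicity-a) (+-monoʳ-< a (n<1+n c))
        (there t∈)   → let v , v-block = occupied⇒inBlock t∈ in v , inBlock-++ p [ a ] v-block
    ; inBlock⇒occupied = inBlock⇒occupied′
    ; length-occupied  = trans (cong suc length-occupied) (sym (length-∷ʳ p))
    }
    where
    multiplicity-a : multiplicity a (p ++ [ a ]) ≡ suc c
    multiplicity-a = count-∷ʳ-accept (a ≟_) p refl
    inBlock⇒occupied′ : ∀ {v t} → InBlock (p ++ [ a ]) v t → t ∈ a + c ∷ occ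
    inBlock⇒occupied′ {v} {t} (v≤t , t<) with v ≟ a
    ... | no v≢a = there (inBlock⇒occupied (v≤t , subst (λ m → t < v + m) (count-∷ʳ-reject (v ≟_) p v≢a) t<))
    ... | yes refl with t ≟ a + c
    ...   | yes t≡spot = here t≡spot
    ...   | no  t≢spot = there (inBlock⇒occupied (v≤t , ≤∧≢⇒< (≤-pred t<1+spot) t≢spot))
      where
      t<1+spot : t < suc (a + c)
      t<1+spot = subst (t <_) (trans (cong (a +_) multiplicity-a) (+-suc a c)) t<

  luckyAux-step : luckyAux (suc (length p)) occ (a ∷ l)
                ≡ firstOccurrences p [ a ] ++ luckyAux (suc (suc (length p))) (a + c ∷ occ) l
  luckyAux-step with a ∈? occ | a ∈? p
  ... | yes _     | yes _   = cong (λ s → luckyAux _ (s ∷ occ) l) firstFree≡spot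
  ... | yes a∈occ | no a∉p  = ⊥-elim (a∉p (occupied⇒seen a∈occ))
  ... | no a∉occ  | yes a∈p = ⊥-elim (a∉occ (seen⇒occupied a∈p))
  ... | no _      | no a∉p  = cong (λ s → suc (length p) ∷ luckyAux _ (s ∷ occ) l) (sym a+c≡a)
    where
    a+c≡a : a + c ≡ a
    a+c≡a = trans (cong (a +_) (count-none (a ≟_) (All.¬Any⇒All¬ p a∉p))) (+-identityʳ a)

luckyAux≡firstOccurrences : ∀ p l {occ} → IsFubiniList (p ++ l) → ParkedInBlocks p occ
  → luckyAux (suc (length p)) occ l ≡ firstOccurrences p l
luckyAux≡firstOccurrences p []      _       _      = refl
luckyAux≡firstOccurrences p (a ∷ l) {occ} fubini parked = begin
  luckyAux (suc (length p)) occ (a ∷ l)                        ≡⟨ luckyAux-step ⟩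
  head ++ luckyAux (suc (suc (length p))) occ′ l               ≡⟨ cong (λ i → head ++ luckyAux (suc i) occ′ l) (length-∷ʳ p) ⟨
  head ++ luckyAux (suc (length (p ++ [ a ]))) occ′ l          ≡⟨ cong (head ++_) (luckyAux≡firstOccurrences (p ++ [ a ]) l fubini′ parked-step) ⟩
  head ++ firstOccurrences (p ++ [ a ]) l                      ≡⟨ firstOccurrences-++ p [ a ] l ⟨
  firstOccurrences p (a ∷ l)                                   ∎
  where
  open ≡-Reasoning
  open ParkingStep fubini parked
  head : List ℕ
  head = firstOccurrences p [ a ]
  occ′ : List ℕ
  occ′ = a + multiplicity a p ∷ occ
  fubini′ : IsFubiniList ((p ++ [ a ]) ++ l)
  fubini′ = subst IsFubiniList (sym (List.++-assoc p [ a ] l)) fubini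

fubini⇒Lucky≡firstOccurrences : ∀ {n} (α : Vec ℕ n) → IsFubiniList (toList α) → Lucky α ≡ firstOccurrences [] (toList α)
fubini⇒Lucky≡firstOccurrences α fubini = luckyAux≡firstOccurrences [] (toList α) fubini parkedInBlocks-[]

-- Adding a last competitor

shift : ℕ → ℕ → ℕ
shift t x with x <? t
... | yes _ = x
... | no  _ = suc x

unshift : ℕ → ℕ → ℕ
unshift t x with x <? t
... | yes _ = x
... | no  _ = pred x

shift-< : ∀ {t x} → x < t → shift t x ≡ x
shift-< {t} {x} x<t with x <? t
... | yes _   = refl
... | no x≮t = ⊥-elim (x≮t x<t)

shift-≥ : ∀ {t x} → t ≤ x → shift t x ≡ suc x
shift-≥ {t} {x} t≤x with x <? t
... | yes x<t = ⊥-elim (<⇒≱ x<t t≤x)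
... | no _    = refl

unshift-< : ∀ {t x} → x < t → unshift t x ≡ x
unshift-< {t} {x} x<t with x <? t
... | yes _   = refl
... | no x≮t = ⊥-elim (x≮t x<t)

unshift-≥ : ∀ {t x} → t ≤ x → unshift t x ≡ pred x
unshift-≥ {t} {x} t≤x with x <? t
... | yes x<t = ⊥-elim (<⇒≱ x<t t≤x)
... | no _    = refl

unshift-shift : ∀ t x → unshift t (shift t x) ≡ x
unshift-shift t x with x <? t
... | yes x<t = unshift-< x<t
... | no  x≮t = unshift-≥ (m≤n⇒m≤1+n (≮⇒≥ x≮t))

shift-unshift : ∀ t {x} → x ≢ t → shift t (unshift t x) ≡ x
shift-unshift t {x} x≢t with x <? t
... | yes x<t = shift-< x<t
shift-unshift t {zero}  x≢t | no x≮t = ⊥-elim (x≢t (sym (n≤0⇒n≡0 (≮⇒≥ x≮t))))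
shift-unshift t {suc x} x≢t | no x≮t = shift-≥ (≤-pred (≤∧≢⇒< (≮⇒≥ x≮t) (x≢t ∘ sym)))

shift-injective : ∀ t {x y} → shift t x ≡ shift t y → x ≡ y
shift-injective t {x} {y} eq = begin
  x                      ≡⟨ unshift-shift t x ⟨
  unshift t (shift t x)  ≡⟨ cong (unshift t) eq ⟩
  unshift t (shift t y)  ≡⟨ unshift-shift t y ⟩
  y                      ∎
  where open ≡-Reasoning

shift-≢ : ∀ t x → shift t x ≢ t
shift-≢ t x with x <? t
... | yes x<t = <⇒≢ x<t
... | no  x≮t = λ 1+x≡t → x≮t (subst (x <_) 1+x≡t ≤-refl)

shift-<-low : ∀ {t a} → a ≤ t → ∀ {y} → shift t y < a ⇔ y < a
shift-<-low {t} a≤t {y} with y <? t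
... | yes _   = mk⇔ id id
... | no y≮t = mk⇔ (λ 1+y<a → ⊥-elim (y≮t (<-≤-trans (n<1+n y) (≤-trans (<⇒≤ 1+y<a) a≤t))))
                   (λ y<a → ⊥-elim (y≮t (<-≤-trans y<a a≤t)))

shift-<-high : ∀ {t x} → t ≤ x → ∀ {y} → shift t y < suc x ⇔ y < x
shift-<-high {t} t≤x {y} with y <? t
... | yes y<t = mk⇔ (λ _ → <-≤-trans y<t t≤x) m<n⇒m<1+n
... | no  _   = mk⇔ ≤-pred s≤s

-- The ranking α with a last competitor of rank w appended: for t = suc w the newcomer ties with
-- the competitors of rank w, for t = w it is alone in a new rank w.
addCompetitor : ℕ → ℕ → List ℕ → List ℕ
addCompetitor t w α = map (shift t) α ++ [ w ]

length-addCompetitor : ∀ t w α → length (addCompetitor t w α) ≡ suc (length α)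
length-addCompetitor t w α = trans (length-∷ʳ (map (shift t) α)) (cong suc (List.length-map (shift t) α))

addCompetitor-injective : ∀ (r : ℕ → ℕ) {α α′ w w′} →
  addCompetitor (r w) w α ≡ addCompetitor (r w′) w′ α′ → α ≡ α′ × w ≡ w′
addCompetitor-injective r {α} {α′} eq with List.∷ʳ-injective (map (shift _) α) (map (shift _) α′) eq
... | shifted≡ , refl = List.map-injective (shift-injective (r _)) shifted≡ , refl

shift-unshift-map : ∀ {t β} → t ∉ β → map (shift t) (map (unshift t) β) ≡ β
shift-unshift-map {t} {β} t∉β = begin
  map (shift t) (map (unshift t) β)  ≡⟨ List.map-∘ β ⟨
  map (shift t ∘ unshift t) β        ≡⟨ List.map-id-local (All.tabulate λ x∈β → shift-unshift t λ where refl → t∉β x∈β) ⟩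
  β                                  ∎
  where open ≡-Reasoning

firstOccurrences-shift : ∀ t α → firstOccurrences [] (map (shift t) α) ≡ firstOccurrences [] α
firstOccurrences-shift t = firstOccurrences-map (shift-injective t) []

module _ {t w : ℕ} (w≤t : w ≤ t) (t≤1+w : t ≤ suc w) (α : List ℕ) where

  private
    countBelow-low : ∀ {a} → a ≤ t → a ≤ w → countBelow a (addCompetitor t w α) ≡ countBelow a α
    countBelow-low {a} a≤t a≤w = trans (count-∷ʳ-reject (_<? a) (map (shift t) α) (≤⇒≯ a≤w))
                                       (count-map (_<? a) (_<? a) (shift t) (shift-<-low a≤t) α)

    countBelow-high : ∀ {x} → t ≤ x → countBelow (suc x) (addCompetitor t w α) ≡ suc (countBelow x α)
    countBelow-high {x} t≤x = trans (count-∷ʳ-accept (_<? suc x) (map (shift t) α) (s≤s (≤-trans w≤t t≤x)))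
                                    (cong suc (count-map (_<? suc x) (_<? x) (shift t) (shift-<-high t≤x) α))

    rank-shift : ∀ x → shift t x ≡ suc (countBelow (shift t x) (addCompetitor t w α)) ⇔ x ≡ suc (countBelow x α)
    rank-shift x with x <? t
    ... | yes x<t rewrite countBelow-low (<⇒≤ x<t) (≤-pred (<-≤-trans x<t t≤1+w)) = mk⇔ id id
    ... | no  x≮t rewrite countBelow-high (≮⇒≥ x≮t)                              = mk⇔ suc-injective (cong suc)

    rank-w : w ≡ suc (countBelow w (addCompetitor t w α)) ⇔ w ≡ suc (countBelow w α)
    rank-w rewrite countBelow-low w≤t ≤-refl = mk⇔ id id

  addCompetitor-fubini⁺ : IsFubiniList α → w ≡ suc (countBelow w α) → IsFubiniList (addCompetitor t w α)
  addCompetitor-fubini⁺ fubini w-rank =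
    All.++⁺ (All.map⁺ (All.map (λ {x} → Equivalence.from (rank-shift x)) fubini)) (Equivalence.from rank-w w-rank ∷ [])

  addCompetitor-fubini⁻ : IsFubiniList (addCompetitor t w α) → IsFubiniList α × w ≡ suc (countBelow w α)
  addCompetitor-fubini⁻ fubini′ with shifted , (w-rank ∷ []) ← All.++⁻ (map (shift t) α) fubini′
    = All.map (λ {x} → Equivalence.to (rank-shift x)) (All.map⁻ shifted) , Equivalence.to rank-w w-rank

isFubini⇔isFubiniList : ∀ {n} (α : Vec ℕ n) → IsFubini α ⇔ IsFubiniList (toList α)
isFubini⇔isFubiniList {n} α = mk⇔
  (λ isFubini → VecAll.toList⁺ (VecAll.lookup⁻ λ i →
     trans (proj₂ (proj₂ (isFubini i))) (cong suc (count-toList (_<? _) α))))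
  (λ fubini → VecAll.lookup⁺ (VecAll.toList⁻ (All.tabulate (entry fubini))))
  where
  entry : IsFubiniList (toList α) → ∀ {a} → a ∈ toList α → 1 ≤ a × a ≤ n × a ≡ suc (Vec.count (_<? a) α)
  entry fubini {a} a∈ = subst (1 ≤_) (sym a≡) (s≤s z≤n)
                      , subst (a ≤_) (Vec.length-toList α) (fubini-≤-length fubini a∈)
                      , trans a≡ (cong suc (sym (count-toList (_<? a) α)))
    where
    a≡ : a ≡ suc (countBelow a (toList α))
    a≡ = All.lookup fubini a∈

toList-injective : ∀ {n} {α β : Vec ℕ n} → toList α ≡ toList β → α ≡ β
toList-injective {α = α} {β} eq = trans (sym (cast-is-id refl α)) (Vec.toList-injective refl α β eq)

tuples-unique : ∀ m k → Unique (tuples m k)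
tuples-unique m zero    = [] ∷ []
tuples-unique m (suc k) = dependentPairs-unique Vec._∷_ Vec.∷-injective (λ _ → tuples m k)
  (Unique.map⁺ suc-injective (Unique.upTo⁺ m)) (All.tabulate λ _ → tuples-unique m k)

∈-tuples : ∀ m {k} (α : Vec ℕ k) → All (λ a → 1 ≤ a × a ≤ m) (toList α) → α ∈ tuples m k
∈-tuples m Vec.[]            []                   = here refl
∈-tuples m (suc a Vec.∷ α)  ((_ , 1+a≤m) ∷ bounds) =
  ∈-dependentPairs⁺ Vec._∷_ Vec.∷-injective (λ _ → tuples m _) (∈-map⁺ suc (∈-upTo⁺ 1+a≤m)) (∈-tuples m α bounds)

luckyFubini? : ∀ {n} (I : List ℕ) (α : Vec ℕ n) → Dec (IsFubini α × Lucky α ≡ I)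
luckyFubini? I α = isFubini? α ×-dec List.≡-dec _≟_ (Lucky α) I

rankingsWithLucky : ℕ → List ℕ → List (List ℕ)
rankingsWithLucky n I = map toList (filter (luckyFubini? I) (tuples n n))

record LuckyFubini (n : ℕ) (I xs : List ℕ) : Set where
  constructor luckyFubini
  field
    length≡ : length xs ≡ n
    fubini  : IsFubiniList xs
    lucky   : firstOccurrences [] xs ≡ I

numFubiniLucky≡length : ∀ n I → numFubiniLucky n I ≡ length (rankingsWithLucky n I)
numFubiniLucky≡length n I = sym (List.length-map toList (filter (luckyFubini? I) (tuples n n)))

rankingsWithLucky-unique : ∀ n I → Unique (rankingsWithLucky n I)
rankingsWithLucky-unique n I = Unique.map⁺ toList-injective (Unique.filter⁺ _ (tuples-unique n n))

∈-rankingsWithLucky⁻ : ∀ {n I xs} → xs ∈ rankingsWithLucky n I → LuckyFubini n I xs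
∈-rankingsWithLucky⁻ {n} {I} xs∈ with α , α∈ , refl ← ∈-map⁻ toList xs∈
                                 with _ , isFubini , Lucky≡I ← ∈-filter⁻ (luckyFubini? I) {xs = tuples n n} α∈
  = luckyFubini (Vec.length-toList α) fubini (trans (sym (fubini⇒Lucky≡firstOccurrences α fubini)) Lucky≡I)
  where
  fubini : IsFubiniList (toList α)
  fubini = Equivalence.to (isFubini⇔isFubiniList α) isFubini

∈-rankingsWithLucky⁺ : ∀ {n I xs} → LuckyFubini n I xs → xs ∈ rankingsWithLucky n I
∈-rankingsWithLucky⁺ {I = I} {xs} (luckyFubini refl fubini lucky) =
  subst (_∈ rankingsWithLucky (length xs) I) (Vec.toList∘fromList xs)
    (∈-map⁺ toList (∈-filter⁺ (luckyFubini? I) (∈-tuples (length xs) α bounds)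
      (Equivalence.from (isFubini⇔isFubiniList α) fubiniα , trans (fubini⇒Lucky≡firstOccurrences α fubiniα) luckyα)))
  where
  α : Vec ℕ (length xs)
  α = fromList xs
  toList-α : toList α ≡ xs
  toList-α = Vec.toList∘fromList xs
  fubiniα : IsFubiniList (toList α)
  fubiniα = subst IsFubiniList (sym toList-α) fubini
  luckyα : firstOccurrences [] (toList α) ≡ I
  luckyα = trans (cong (firstOccurrences []) toList-α) lucky
  bounds : All (λ a → 1 ≤ a × a ≤ length xs) (toList α)
  bounds = All.tabulate λ {a} a∈ → subst (1 ≤_) (sym (All.lookup fubiniα a∈)) (s≤s z≤n)
                                 , subst (a ≤_) (Vec.length-toList α) (fubini-≤-length fubiniα a∈)

-- Removing the last competitor

-- A tie gives rank w multiplicity at least 2, so the next rank is at least w + 2.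
fubini-tie-gap : ∀ {β w} → IsFubiniList (β ++ [ w ]) → w ∈ β → suc w ∉ β
fubini-tie-gap {β} {w} fubini w∈β 1+w∈β = 1+n≰n (begin
  suc (suc w)                      ≡⟨ +-comm w 2 ⟨
  w + 2                            ≤⟨ +-monoʳ-≤ w two≤multiplicity ⟩
  w + multiplicity w (β ++ [ w ])  ≤⟨ fubini-separated fubini (∈-++⁺ˡ w∈β) (∈-++⁺ˡ 1+w∈β) (n<1+n w) ⟩
  suc w                            ∎)
  where
  open ≤-Reasoning
  two≤multiplicity : 2 ≤ multiplicity w (β ++ [ w ])
  two≤multiplicity = subst (2 ≤_) (sym (count-∷ʳ-accept (w ≟_) β refl)) (s≤s (Any⇒count>0 (w ≟_) w∈β))

module _ {n : ℕ} {I J : List ℕ} (pair : List ℕ → ℕ → List ℕ)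
         (pair-injective : ∀ {α α′ v v′} → pair α v ≡ pair α′ v′ → α ≡ α′ × v ≡ v′)
         (fibre : List ℕ → List ℕ) (c : ℕ)
         (fibre-uniform : ∀ {α} → LuckyFubini n I α → Unique (fibre α) × length (fibre α) ≡ c)
         (add : ∀ {α v} → LuckyFubini n I α → v ∈ fibre α → LuckyFubini (suc n) J (pair α v))
         (remove : ∀ {β w} → length β ≡ n → LuckyFubini (suc n) J (β ++ [ w ])
                 → ∃₂ λ α v → LuckyFubini n I α × v ∈ fibre α × β ++ [ w ] ≡ pair α v)
         where

  numFubiniLucky-suc : numFubiniLucky (suc n) J ≡ numFubiniLucky n I * c
  numFubiniLucky-suc = begin
    numFubiniLucky (suc n) J                 ≡⟨ numFubiniLucky≡length (suc n) J ⟩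
    length (rankingsWithLucky (suc n) J)     ≡⟨ length-uniformFibres pair pair-injective fibre c
                                                  (rankingsWithLucky-unique n I) (rankingsWithLucky-unique (suc n) J)
                                                  (All.tabulate (fibre-uniform ∘ ∈-rankingsWithLucky⁻)) onto
                                                  (λ α∈ v∈ → ∈-rankingsWithLucky⁺ (add (∈-rankingsWithLucky⁻ α∈) v∈)) ⟩
    length (rankingsWithLucky n I) * c       ≡⟨ cong (_* c) (numFubiniLucky≡length n I) ⟨
    numFubiniLucky n I * c                   ∎
    where
    open ≡-Reasoning
    onto : ∀ {z} → z ∈ rankingsWithLucky (suc n) J → ∃₂ λ α v → α ∈ rankingsWithLucky n I × v ∈ fibre α × z ≡ pair α v
    onto {z} z∈ with ranking ← ∈-rankingsWithLucky⁻ z∈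
                with β , w , refl , length-β ← ∷ʳ-view z (LuckyFubini.length≡ ranking)
                with α , v , α-ranking , v∈ , z≡ ← remove length-β ranking
      = α , v , ∈-rankingsWithLucky⁺ α-ranking , v∈ , z≡

module _ {n : ℕ} {I : List ℕ} where

  private
    lucky-length : ∀ {α} → LuckyFubini n I α → length (distinctValues [] α) ≡ length I
    lucky-length {α} ranking = trans (length-distinctValues [] α) (cong length (LuckyFubini.lucky ranking))

  tie-add : ∀ {α v} → LuckyFubini n I α → v ∈ distinctValues [] α → LuckyFubini (suc n) I (addCompetitor (suc v) v α)
  tie-add {α} {v} (luckyFubini length≡ fubini lucky) v∈ = luckyFubini
    (trans (length-addCompetitor (suc v) v α) (cong suc length≡))
    (addCompetitor-fubini⁺ (n≤1+n v) ≤-refl α fubini (All.lookup fubini v∈α))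
    (begin
      firstOccurrences [] (map (shift (suc v)) α ++ [ v ])  ≡⟨ firstOccurrences-∷ʳ-∈ (map (shift (suc v)) α) v∈shifted ⟩
      firstOccurrences [] (map (shift (suc v)) α)           ≡⟨ firstOccurrences-shift (suc v) α ⟩
      firstOccurrences [] α                                 ≡⟨ lucky ⟩
      I                                                     ∎)
    where
    open ≡-Reasoning
    v∈α : v ∈ α
    v∈α = ∈-distinctValues⁻ [] α v∈
    v∈shifted : v ∈ map (shift (suc v)) α
    v∈shifted = subst (_∈ map (shift (suc v)) α) (shift-< ≤-refl) (∈-map⁺ (shift (suc v)) v∈α)

  tie-remove : All (_≤ n) I → ∀ {β w} → length β ≡ n → LuckyFubini (suc n) I (β ++ [ w ])
             → ∃₂ λ α v → LuckyFubini n I α × v ∈ distinctValues [] α × β ++ [ w ] ≡ addCompetitor (suc v) v α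
  tie-remove I≤n {β} {w} length-β (luckyFubini _ fubini lucky) with w ∈? β
  ... | no w∉β = ⊥-elim (1+n≰n (All.lookup I≤n (subst (suc n ∈_) lucky′ (∈-++⁺ʳ (firstOccurrences [] β) (here refl)))))
    where
    lucky′ : firstOccurrences [] β ++ [ suc n ] ≡ I
    lucky′ = trans (cong (λ m → firstOccurrences [] β ++ [ suc m ]) (sym length-β)) (trans (sym (firstOccurrences-∷ʳ-∉ β w∉β)) lucky)
  ... | yes w∈β = α , w , luckyFubini lengthα fubiniα luckyα , ∈-distinctValues[]⁺ w∈α , sym β∷ʳw≡
    where
    open ≡-Reasoning
    α : List ℕ
    α = map (unshift (suc w)) β
    lengthα : length α ≡ n
    lengthα = trans (List.length-map _ β) length-β
    shifted≡ : map (shift (suc w)) α ≡ β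
    shifted≡ = shift-unshift-map (fubini-tie-gap fubini w∈β)
    β∷ʳw≡ : addCompetitor (suc w) w α ≡ β ++ [ w ]
    β∷ʳw≡ = cong (_++ [ w ]) shifted≡
    fubiniα : IsFubiniList α
    fubiniα = proj₁ (addCompetitor-fubini⁻ (n≤1+n w) ≤-refl α (subst IsFubiniList (sym β∷ʳw≡) fubini))
    luckyα : firstOccurrences [] α ≡ I
    luckyα = begin
      firstOccurrences [] α                          ≡⟨ firstOccurrences-shift (suc w) α ⟨
      firstOccurrences [] (map (shift (suc w)) α)    ≡⟨ cong (firstOccurrences []) shifted≡ ⟩
      firstOccurrences [] β                          ≡⟨ firstOccurrences-∷ʳ-∈ β w∈β ⟨
      firstOccurrences [] (β ++ [ w ])               ≡⟨ lucky ⟩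
      I                                              ∎
    w∈α : w ∈ α
    w∈α = subst (_∈ α) (unshift-< ≤-refl) (∈-map⁺ (unshift (suc w)) w∈β)

  numFubiniLucky-tie : All (_≤ n) I → numFubiniLucky (suc n) I ≡ numFubiniLucky n I * length I
  numFubiniLucky-tie I≤n = numFubiniLucky-suc (λ α v → addCompetitor (suc v) v α) (addCompetitor-injective suc)
    (distinctValues []) (length I) (λ {α} ranking → distinctValues-unique [] α , lucky-length ranking) tie-add (tie-remove I≤n)

  new-add : ∀ {α g} → LuckyFubini n I α → g ∈ distinctValues [] α ++ [ suc n ]
          → LuckyFubini (suc n) (I ++ [ suc n ]) (addCompetitor g g α)
  new-add {α} {g} (luckyFubini length≡ fubini lucky) g∈ = luckyFubini
    (trans (length-addCompetitor g g α) (cong suc length≡))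
    (addCompetitor-fubini⁺ ≤-refl (n≤1+n g) α fubini g-rank)
    (begin
      firstOccurrences [] (map (shift g) α ++ [ g ])                      ≡⟨ firstOccurrences-∷ʳ-∉ (map (shift g) α) g∉shifted ⟩
      firstOccurrences [] (map (shift g) α) ++ [ suc (length (map (shift g) α)) ]
        ≡⟨ cong₂ (λ xs m → xs ++ [ suc m ]) (firstOccurrences-shift g α) (trans (List.length-map (shift g) α) length≡) ⟩
      firstOccurrences [] α ++ [ suc n ]                                  ≡⟨ cong (_++ [ suc n ]) lucky ⟩
      I ++ [ suc n ]                                                      ∎)
    where
    open ≡-Reasoning
    g-rank : g ≡ suc (countBelow g α)
    g-rank with ∈-++⁻ (distinctValues [] α) g∈
    ... | inj₁ g∈dv        = All.lookup fubini (∈-distinctValues⁻ [] α g∈dv)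
    ... | inj₂ (here refl) = cong suc (sym (subst (λ m → countBelow (suc m) α ≡ m) length≡ (fubini-countBelow-top fubini)))
    g∉shifted : g ∉ map (shift g) α
    g∉shifted g∈shifted with x , _ , g≡ ← ∈-map⁻ (shift g) g∈shifted = shift-≢ g x (sym g≡)

  new-remove : ∀ {β w} → length β ≡ n → LuckyFubini (suc n) (I ++ [ suc n ]) (β ++ [ w ])
             → ∃₂ λ α g → LuckyFubini n I α × g ∈ distinctValues [] α ++ [ suc n ] × β ++ [ w ] ≡ addCompetitor g g α
  new-remove {β} {w} length-β (luckyFubini _ fubini lucky) with w ∈? β
  ... | yes w∈β = ⊥-elim (1+n≰n (subst (suc n ≤_) length-β (firstOccurrences-≤ [] β 1+n∈)))
    where
    1+n∈ : suc n ∈ firstOccurrences [] β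
    1+n∈ = subst (suc n ∈_) (trans (sym lucky) (firstOccurrences-∷ʳ-∈ β w∈β)) (∈-++⁺ʳ I (here refl))
  ... | no w∉β = α , w , luckyFubini lengthα fubiniα luckyα , w∈ , sym β∷ʳw≡
    where
    open ≡-Reasoning
    α : List ℕ
    α = map (unshift w) β
    lengthα : length α ≡ n
    lengthα = trans (List.length-map _ β) length-β
    shifted≡ : map (shift w) α ≡ β
    shifted≡ = shift-unshift-map w∉β
    β∷ʳw≡ : addCompetitor w w α ≡ β ++ [ w ]
    β∷ʳw≡ = cong (_++ [ w ]) shifted≡
    fubiniα×w-rank : IsFubiniList α × w ≡ suc (countBelow w α)
    fubiniα×w-rank = addCompetitor-fubini⁻ ≤-refl (n≤1+n w) α (subst IsFubiniList (sym β∷ʳw≡) fubini)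
    fubiniα : IsFubiniList α
    fubiniα = proj₁ fubiniα×w-rank
    luckyα : firstOccurrences [] α ≡ I
    luckyα = List.∷ʳ-injectiveˡ (firstOccurrences [] α) I (begin
      firstOccurrences [] α ++ [ suc n ]                        ≡⟨ cong₂ (λ xs m → xs ++ [ suc m ]) (firstOccurrences-shift w α) length-β ⟨
      firstOccurrences [] (map (shift w) α) ++ [ suc (length β) ] ≡⟨ cong (λ xs → firstOccurrences [] xs ++ [ suc (length β) ]) shifted≡ ⟩
      firstOccurrences [] β ++ [ suc (length β) ]               ≡⟨ firstOccurrences-∷ʳ-∉ β w∉β ⟨
      firstOccurrences [] (β ++ [ w ])                          ≡⟨ lucky ⟩
      I ++ [ suc n ]                                            ∎)
    w≤1+n : w ≤ suc n
    w≤1+n = subst (w ≤_) (trans (length-∷ʳ β) (cong suc length-β)) (fubini-≤-length fubini (∈-++⁺ʳ β (here refl)))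
    w∈ : w ∈ distinctValues [] α ++ [ suc n ]
    w∈ with w ≤? n
    ... | yes w≤n = ∈-++⁺ˡ (∈-distinctValues[]⁺ (fubini-∈ fubiniα (proj₂ fubiniα×w-rank) (subst (w ≤_) (sym lengthα) w≤n)))
    ... | no  w≰n = ∈-++⁺ʳ (distinctValues [] α) (here (≤-antisym w≤1+n (≰⇒> w≰n)))

  numFubiniLucky-new : numFubiniLucky (suc n) (I ++ [ suc n ]) ≡ numFubiniLucky n I * suc (length I)
  numFubiniLucky-new = numFubiniLucky-suc (λ α g → addCompetitor g g α) (addCompetitor-injective id)
    (λ α → distinctValues [] α ++ [ suc n ]) (suc (length I)) fibre-uniform new-add new-remove
    where
    fibre-uniform : ∀ {α} → LuckyFubini n I α
      → Unique (distinctValues [] α ++ [ suc n ]) × length (distinctValues [] α ++ [ suc n ]) ≡ suc (length I)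
    fibre-uniform {α} ranking@(luckyFubini length≡ fubini _) =
        Unique.++⁺ (distinctValues-unique [] α) ([] ∷ []) top-new
      , trans (length-∷ʳ (distinctValues [] α)) (cong suc (lucky-length ranking))
      where
      top-new : Disjoint (distinctValues [] α) [ suc n ]
      top-new (1+n∈ , here refl) = 1+n≰n (subst (suc n ≤_) length≡ (fubini-≤-length fubini (∈-distinctValues⁻ [] α 1+n∈)))

-- The product formula

prodFrom-suc : ∀ ℓ i is n → All (_≤ n) (i ∷ is)
  → prodFrom ℓ (suc n) (i ∷ is) ≡ prodFrom ℓ n (i ∷ is) * (ℓ + length is)
prodFrom-suc ℓ i []      n (i≤n ∷ []) = begin
  ℓ ^ (suc (suc n) ∸ i)  ≡⟨ cong (ℓ ^_) (+-∸-assoc 1 (m≤n⇒m≤1+n i≤n)) ⟩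
  ℓ * ℓ ^ (suc n ∸ i)    ≡⟨ *-comm ℓ _ ⟩
  ℓ ^ (suc n ∸ i) * ℓ    ≡⟨ cong (ℓ ^ (suc n ∸ i) *_) (+-identityʳ ℓ) ⟨
  ℓ ^ (suc n ∸ i) * (ℓ + 0) ∎
  where open ≡-Reasoning
prodFrom-suc ℓ i (j ∷ is) n (_ ∷ j∷is≤n) = begin
  ℓ ^ (j ∸ i) * prodFrom (suc ℓ) (suc n) (j ∷ is)                   ≡⟨ cong (ℓ ^ (j ∸ i) *_) (prodFrom-suc (suc ℓ) j is n j∷is≤n) ⟩
  ℓ ^ (j ∸ i) * (prodFrom (suc ℓ) n (j ∷ is) * (suc ℓ + length is)) ≡⟨ *-assoc (ℓ ^ (j ∸ i)) _ _ ⟨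
  ℓ ^ (j ∸ i) * prodFrom (suc ℓ) n (j ∷ is) * (suc ℓ + length is)   ≡⟨ cong (ℓ ^ (j ∸ i) * prodFrom (suc ℓ) n (j ∷ is) *_) (+-suc ℓ (length is)) ⟨
  ℓ ^ (j ∸ i) * prodFrom (suc ℓ) n (j ∷ is) * (ℓ + suc (length is)) ∎
  where open ≡-Reasoning

prodFrom-∷ʳ : ∀ ℓ i is n → All (_≤ n) (i ∷ is)
  → prodFrom ℓ (suc n) ((i ∷ is) ++ [ suc n ]) ≡ prodFrom ℓ n (i ∷ is) * suc (ℓ + length is)
prodFrom-∷ʳ ℓ i []       n _ = begin
  ℓ ^ (suc n ∸ i) * suc ℓ ^ (suc (suc n) ∸ suc n)  ≡⟨ cong (λ k → ℓ ^ (suc n ∸ i) * suc ℓ ^ k) (m+n∸n≡m 1 n) ⟩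
  ℓ ^ (suc n ∸ i) * (suc ℓ * 1)                    ≡⟨ cong (λ k → ℓ ^ (suc n ∸ i) * suc k) (trans (*-identityʳ ℓ) (sym (+-identityʳ ℓ))) ⟩
  ℓ ^ (suc n ∸ i) * suc (ℓ + 0)                    ∎
  where open ≡-Reasoning
prodFrom-∷ʳ ℓ i (j ∷ is) n (_ ∷ j∷is≤n) = begin
  ℓ ^ (j ∸ i) * prodFrom (suc ℓ) (suc n) ((j ∷ is) ++ [ suc n ])        ≡⟨ cong (ℓ ^ (j ∸ i) *_) (prodFrom-∷ʳ (suc ℓ) j is n j∷is≤n) ⟩
  ℓ ^ (j ∸ i) * (prodFrom (suc ℓ) n (j ∷ is) * suc (suc ℓ + length is)) ≡⟨ *-assoc (ℓ ^ (j ∸ i)) _ _ ⟨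
  ℓ ^ (j ∸ i) * prodFrom (suc ℓ) n (j ∷ is) * suc (suc ℓ + length is)   ≡⟨ cong (λ k → ℓ ^ (j ∸ i) * prodFrom (suc ℓ) n (j ∷ is) * suc k) (+-suc ℓ (length is)) ⟨
  ℓ ^ (j ∸ i) * prodFrom (suc ℓ) n (j ∷ is) * suc (ℓ + suc (length is)) ∎
  where open ≡-Reasoning

split-last : ∀ m xs → Linked _<_ xs → All (_≤ suc m) xs
           → All (_≤ m) xs ⊎ ∃ λ ys → xs ≡ ys ++ [ suc m ] × All (_≤ m) ys
split-last m []           _            _                 = inj₁ []
split-last m (x ∷ [])     _            (x≤1+m ∷ []) with x ≤? m
... | yes x≤m = inj₁ (x≤m ∷ [])
... | no  x≰m = inj₂ ([] , cong [_] (≤-antisym x≤1+m (≰⇒> x≰m)) , [])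
split-last m (x ∷ y ∷ xs) (x<y ∷ y∷xs↑) (_ ∷ y∷xs≤1+m@(y≤1+m ∷ _)) with split-last m (y ∷ xs) y∷xs↑ y∷xs≤1+m
... | inj₁ y∷xs≤m@(y≤m ∷ _)     = inj₁ (≤-trans (<⇒≤ x<y) y≤m ∷ y∷xs≤m)
... | inj₂ (ys , y∷xs≡ , ys≤m) = inj₂ (x ∷ ys , cong (x ∷_) y∷xs≡ , ≤-pred (<-≤-trans x<y y≤1+m) ∷ ys≤m)

numFubiniLucky≡prodFrom : ∀ m rest → Linked _<_ (1 ∷ rest) → All (_≤ suc m) (1 ∷ rest)
                        → numFubiniLucky (suc m) (1 ∷ rest) ≡ prodFrom 1 (suc m) (1 ∷ rest)
numFubiniLucky≡prodFrom zero    []      _               _                   = refl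
numFubiniLucky≡prodFrom zero    (j ∷ _) (1<j ∷ _)       (_ ∷ j≤1 ∷ _)       = ⊥-elim (<⇒≱ 1<j j≤1)
numFubiniLucky≡prodFrom (suc m) rest    increasing      bounded with split-last (suc m) (1 ∷ rest) increasing bounded
... | inj₁ bounded′ = begin
  numFubiniLucky (suc (suc m)) (1 ∷ rest)                 ≡⟨ numFubiniLucky-tie bounded′ ⟩
  numFubiniLucky (suc m) (1 ∷ rest) * suc (length rest)   ≡⟨ cong (_* suc (length rest)) (numFubiniLucky≡prodFrom m rest increasing bounded′) ⟩
  prodFrom 1 (suc m) (1 ∷ rest) * suc (length rest)       ≡⟨ prodFrom-suc 1 1 rest (suc m) bounded′ ⟨
  prodFrom 1 (suc (suc m)) (1 ∷ rest)                     ∎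
  where open ≡-Reasoning
... | inj₂ ([]          , () , _)
... | inj₂ (1 ∷ rest′   , refl , bounded′) = begin
  numFubiniLucky (suc (suc m)) ((1 ∷ rest′) ++ [ suc (suc m) ])        ≡⟨ numFubiniLucky-new {suc m} {1 ∷ rest′} ⟩
  numFubiniLucky (suc m) (1 ∷ rest′) * suc (suc (length rest′))        ≡⟨ cong (_* suc (suc (length rest′))) ih ⟩
  prodFrom 1 (suc m) (1 ∷ rest′) * suc (suc (length rest′))            ≡⟨ prodFrom-∷ʳ 1 1 rest′ (suc m) bounded′ ⟨
  prodFrom 1 (suc (suc m)) ((1 ∷ rest′) ++ [ suc (suc m) ])            ∎
  where
  open ≡-Reasoning
  ih : numFubiniLucky (suc m) (1 ∷ rest′) ≡ prodFrom 1 (suc m) (1 ∷ rest′)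
  ih = numFubiniLucky≡prodFrom m rest′ (Linked-∷ʳ⁻ (1 ∷ rest′) increasing) bounded′

theorem2p19 : (n : ℕ) → 1 ≤ n → (is : List ℕ) → (rest : List ℕ) → is ≡ 1 ∷ rest
    → Linked _<_ is → All (λ i → i ≤ n) is
    → Σ (Vec ℕ n) (λ α → IsFubini α × Lucky α ≡ is)
    → numFubiniLucky n is ≡ prodFrom 1 n is
theorem2p19 (suc m) _ .(1 ∷ rest) rest refl increasing bounded _ = numFubiniLucky≡prodFrom m rest increasing bounded
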